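{- Let $A$ and $B$ be posets with top and bottom, and let $G$ and $H$ be games over $A$ and $B$, respectively. If $G$ and $H$ are realizable as monotone set coloring games, then so is the game $G+H$ over $A\times B$.
   Context: Games over a poset $C$: atomic $[x]$ ($x\in C$) with no options, or composite $\{L\mid R\}$ with non-empty sets of left and right options. $\le$ and $\lhd$ by mutual recursion: $G\le H$ iff every left option $G^L$ satisfies $G^L\lhd H$, every right option $H^R$ satisfies $G\lhd H^R$, and if $G$ or $H$ is atomic then $G\lhd H$; $G\lhd H$ iff some $G^R\le H$, or $G\le$ some $H^L$, or $G=[x],H=[y]$ with $x\le y$; $G\equiv H$ iff $G\le H$ and $H\le G$. Sum: $G+H=\{G^L+H,G+H^L\mid G^R+H,G+H^R\}$ if at least one of $G,H$ is composite (atomic games contribute no options), and $[x]+[y]=[(x,y)]$. A monotone set coloring game $S$ over $C$ is a pair $(|S|,\phi_S)$ with $|S|$ a finite set of cells and $\phi_S:\{\bot,\top\}^{|S|}\to C$ monotone (pointwise order). Positions are maps $p:|S|\to\{\top,\bot,\star\}$, atomic if no $\star$. $[\![p]\!]=[\phi_S(p)]$ if $p$ is atomic, else $\{[\![p^L]\!]\mid[\![p^R]\!]\}$ where $p^L$ (resp. $p^R$) ranges over positions obtained by changing one $\star$-cell to $\top$ (resp. $\bot$); $[\![S]\!]$ is $[\![\cdot]\!]$ of the all-$\star$ position. $G$ is realizable if $G\equiv[\![S]\!]$ for some such $S$ over the same poset. -}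

module Defs where

open import Level using (Level; _⊔_)
open import Data.Nat using (ℕ; zero; suc)
open import Data.Fin using (Fin; splitAt)
open import Data.Bool using (Bool; true; false)
import Data.Bool as Bool
import Data.Fin
import Data.List
import Data.Nat
open import Data.Sum using (_⊎_; inj₁; inj₂; [_,_]′)
open import Data.Product using (Σ; Σ-syntax; _×_; _,_)
open import Data.List using (List; []; _∷_; length; lookup)
open import Relation.Binary.Bundles using (Poset)
open import Relation.Binary.PropositionalEquality using (_≡_)
open import Relation.Nullary using (Dec; yes; no)
open import Data.Fin using (_≟_)
open import Data.Product.Relation.Binary.Pointwise.NonDependent using (×-poset)

private variable c ℓ₁ ℓ₂ c' ℓ₁' ℓ₂' : Level

HasTop : Poset c ℓ₁ ℓ₂ → Set (c ⊔ ℓ₂)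
HasTop P = Σ[ t ∈ Carrier ] (∀ x → x ≤ t) where open Poset P

HasBottom : Poset c ℓ₁ ℓ₂ → Set (c ⊔ ℓ₂)
HasBottom P = Σ[ b ∈ Carrier ] (∀ x → b ≤ x) where open Poset P

-- Games over a set C: atomic [x], or composite {L | R} with non-empty
-- (finite) families of left and right options.

data Game {c} (C : Set c) : Set c where
  atom : C → Game C
  comp : {m n : ℕ} → (Fin (suc m) → Game C) → (Fin (suc n) → Game C) → Game C

module GameOrder (P : Poset c ℓ₁ ℓ₂) where
  open Poset P renaming (_≤_ to _≤C_)

  mutual
    _≤G_ : Game Carrier → Game Carrier → Set ℓ₂
    atom x ≤G atom y = atom x ◁ atom y
    atom x ≤G comp L' R' = (∀ j → atom x ◁ R' j) × (atom x ◁ comp L' R')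
    comp L R ≤G atom y = (∀ i → L i ◁ atom y) × (comp L R ◁ atom y)
    comp L R ≤G comp L' R' = (∀ i → L i ◁ comp L' R') × (∀ j → comp L R ◁ R' j)

    _◁_ : Game Carrier → Game Carrier → Set ℓ₂
    atom x ◁ atom y = x ≤C y
    atom x ◁ comp L' R' = Σ[ j ∈ _ ] (atom x ≤G L' j)
    comp L R ◁ atom y = Σ[ i ∈ _ ] (R i ≤G atom y)
    comp L R ◁ comp L' R' = (Σ[ i ∈ _ ] (R i ≤G comp L' R')) ⊎ (Σ[ j ∈ _ ] (comp L R ≤G L' j))

  _≡G_ : Game Carrier → Game Carrier → Set ℓ₂
  G ≡G H = (G ≤G H) × (H ≤G G)

append : ∀ {a} {X : Set a} {m n : ℕ} → (Fin (suc m) → X) → (Fin (suc n) → X) → Fin (suc (m Data.Nat.+ suc n)) → X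
append {m = m} f g i = [ f , g ]′ (splitAt (suc m) i)

_+G_ : ∀ {a b} {A : Set a} {B : Set b} → Game A → Game B → Game (A × B)
atom x +G atom y = atom (x , y)
atom x +G comp L' R' = comp (λ j → atom x +G L' j) (λ j → atom x +G R' j)
comp L R +G atom y = comp (λ i → L i +G atom y) (λ i → R i +G atom y)
comp L R +G comp L' R' =
  comp (append (λ i → L i +G comp L' R') (λ j → comp L R +G L' j))
       (append (λ i → R i +G comp L' R') (λ j → comp L R +G R' j))

data Cell : Set where
  ⊤c ⊥c ⋆c : Cell

-- Bool with false (⊥) ≤ true (⊤); colorings are maps Fin n → Bool
record MSCG {c ℓ₁ ℓ₂} (P : Poset c ℓ₁ ℓ₂) : Set (c ⊔ ℓ₂) where
  open Poset P renaming (_≤_ to _≤C_)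
  field
    size     : ℕ
    φ        : (Fin size → Bool) → Carrier
    monotone : ∀ u v → (∀ i → u i Bool.≤ v i) → φ u ≤C φ v

module _ {P : Poset c ℓ₁ ℓ₂} (S : MSCG P) where
  open Poset P
  open MSCG S

  stars : ∀ {k} → (Fin k → Cell) → List (Fin k)
  stars {zero} p = []
  stars {suc k} p with p Data.Fin.zero
  ... | ⋆c = Data.Fin.zero ∷ Data.List.map Data.Fin.suc (stars (λ i → p (Data.Fin.suc i)))
  ... | ⊤c = Data.List.map Data.Fin.suc (stars (λ i → p (Data.Fin.suc i)))
  ... | ⊥c = Data.List.map Data.Fin.suc (stars (λ i → p (Data.Fin.suc i)))

  -- the coloring of an atomic position (⋆ never occurs there)
  toColoring : (Fin size → Cell) → Fin size → Bool
  toColoring p i with p i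
  ... | ⊤c = true
  ... | ⊥c = false
  ... | ⋆c = false

  set : (Fin size → Cell) → Fin size → Cell → Fin size → Cell
  set p i v j with i ≟ j
  ... | yes _ = v
  ... | no  _ = p j

  -- ⟦p⟧, computed with fuel k; called with k = number of ⋆-cells of p,
  -- each move removes exactly one ⋆, so the fuel never runs out early.
  ⟦_⟧pos : ℕ → (Fin size → Cell) → Game Carrier
  ⟦ k ⟧pos p with stars p
  ⟦ k ⟧pos p | [] = atom (φ (toColoring p))
  ⟦ zero ⟧pos p | _ ∷ _ = atom (φ (toColoring p))  -- unreachable
  ⟦ suc k ⟧pos p | s ∷ ss =
    comp {m = length ss} {n = length ss}
         (λ t → ⟦ k ⟧pos (set p (lookup (s ∷ ss) t) ⊤c))
         (λ t → ⟦ k ⟧pos (set p (lookup (s ∷ ss) t) ⊥c))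

  -- ⟦S⟧ : the all-⋆ position (which has exactly `size` ⋆-cells)
  ⟦S⟧ : Game Carrier
  ⟦S⟧ = ⟦ size ⟧pos (λ _ → ⋆c)

⟦_⟧ : {P : Poset c ℓ₁ ℓ₂} → MSCG P → Game (Poset.Carrier P)
⟦ S ⟧ = ⟦S⟧ S

Realizable : (P : Poset c ℓ₁ ℓ₂) → Game (Poset.Carrier P) → Set (c ⊔ ℓ₂)
Realizable P G = Σ[ S ∈ MSCG P ] (G ≡G ⟦ S ⟧)
  where open GameOrder P

_×P_ : Poset c ℓ₁ ℓ₂ → Poset c' ℓ₁' ℓ₂' → Poset (c ⊔ c') (ℓ₁ ⊔ ℓ₁') (ℓ₂ ⊔ ℓ₂')
_×P_ = ×-poset

-- The game tree of a coloring game S ⊕ T, whose cells are those of S and of T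
-- side by side and whose colouring map is φ_S × φ_T, is isomorphic to
-- ⟦ S ⟧ + ⟦ T ⟧: a move colours a cell of one of the two halves. It remains to
-- transport G ≡ ⟦ S ⟧ and H ≡ ⟦ T ⟧ through the sum. Monotonicity of the sum is
-- not automatic over posets: comparing atoms on one side needs the relation ◁
-- on the other, and ≤ does not imply ◁. But coloring games are eager (since φ
-- is monotone, colouring a cell never hurts the player who colours it), and for
-- eager games ≤ does imply ◁, so the inductive proof of monotonicity goes
-- through as soon as one game of each compared pair is eager.

module Submission where

open import Defs
open import Level using (Level; _⊔_; Lift)
open import Data.Empty using (⊥; ⊥-elim)
open import Data.Unit using (⊤; tt)
open import Data.Sum using (_⊎_; inj₁; inj₂; map₁; map₂)
open import Data.Product using (∃; _×_; _,_; proj₁)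
open import Relation.Binary.Bundles using (Poset)
open import Function using (_∘_)
open import Relation.Binary.PropositionalEquality using (_≡_; _≢_; _≗_; refl; sym; trans; cong; subst)
open import Relation.Nullary using (¬_; Dec; yes; no)
open import Data.Nat using (ℕ; zero; suc; _+_; z≤n; s≤s; s≤s⁻¹)
  renaming (_≤_ to _≤ℕ_; _<_ to _<ℕ_)
open import Data.Nat.Properties using (m≤n⇒m≤1+n; m<n⇒m<1+n; <-≤-trans; <-irrefl)
open import Data.Bool using () renaming (_≤_ to _≤B_)
import Data.Bool.Properties as Bool
open import Data.List using ([]; _∷_; length; map; lookup)
open import Data.List.Properties using (length-map)
open import Data.List.Membership.Propositional using (_∈_)
open import Data.List.Membership.Propositional.Properties using (∈-map⁺; ∈-map⁻; ∈-lookup)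
open import Data.List.Relation.Unary.Any using (here; there; index)
open import Data.List.Relation.Unary.Any.Properties using (lookup-index)
open import Data.Fin using (Fin; zero; suc; _≟_; splitAt; _↑ˡ_; _↑ʳ_)
open import Data.Fin.Properties
  using (↑ˡ-injective; ↑ʳ-injective; splitAt-↑ˡ; splitAt-↑ʳ; splitAt⁻¹-↑ˡ; splitAt⁻¹-↑ʳ)
open import Data.Vec.Functional.Properties using (lookup-++ˡ; lookup-++ʳ)
open import Induction.WellFounded using (Acc; acc; WellFounded)

-- Options and the subgame order

data Side : Set where
  left right : Side

module _ {c} {C : Set c} where

  infix 4 _∈[_]_ _≺_

  _∈[_]_ : Game C → Side → Game C → Set c
  Z ∈[ _ ]     atom _   = Lift c ⊥
  Z ∈[ left ]  comp L R = ∃ λ i → L i ≡ Z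
  Z ∈[ right ] comp L R = ∃ λ j → R j ≡ Z

  IsAtomic : Game C → Set
  IsAtomic (atom _)   = ⊤
  IsAtomic (comp _ _) = ⊥

  option⇒¬atomic : ∀ {s X Z} → Z ∈[ s ] X → ¬ IsAtomic X
  option⇒¬atomic {X = comp _ _} _ ()

  data _≺_ (Z X : Game C) : Set c where
    option : ∀ {s} → Z ∈[ s ] X → Z ≺ X

  ≺-wellFounded : WellFounded _≺_
  ≺-wellFounded (atom x)   = acc λ { (option ()) }
  ≺-wellFounded (comp L R) = acc λ where
    (option {left}  (i , refl)) → ≺-wellFounded (L i)
    (option {right} (j , refl)) → ≺-wellFounded (R j)

-- The order on games

module GameOrderProperties {c ℓ₁ ℓ₂} (P : Poset c ℓ₁ ℓ₂) where

  open Poset P using (Carrier) renaming (_≤_ to _≤C_; trans to ≤C-trans)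
  open GameOrder P using (_≤G_) renaming (_◁_ to _◁G_)

  private variable
    x y : Carrier
    s : Side
    X Y Z : Game Carrier

  infix 4 _≤_ _◁_ _≅_

  -- The relations of GameOrder compute on their arguments; the records let
  -- Agda recover the games from the type.
  record _≤_ (X Y : Game Carrier) : Set ℓ₂ where
    constructor le
    field unle : X ≤G Y

  record _◁_ (X Y : Game Carrier) : Set ℓ₂ where
    constructor lf
    field unlf : X ◁G Y

  open _≤_ public
  open _◁_ public

  ≤-atoms : x ≤C y → atom x ≤ atom y
  ≤-atoms = le

  ≤-intro : (∀ {Z} → Z ∈[ left ] X → Z ◁ Y) → (∀ {Z} → Z ∈[ right ] Y → X ◁ Z)
          → (IsAtomic X ⊎ IsAtomic Y → X ◁ Y) → X ≤ Y
  ≤-intro {atom x}   {atom y}   f g h = le (unlf (h (inj₁ tt)))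
  ≤-intro {atom x}   {comp L R} f g h = le ((λ j → unlf (g (j , refl))) , unlf (h (inj₁ tt)))
  ≤-intro {comp L R} {atom y}   f g h = le ((λ i → unlf (f (i , refl))) , unlf (h (inj₂ tt)))
  ≤-intro {comp L R} {comp _ _} f g h = le ((λ i → unlf (f (i , refl))) , (λ j → unlf (g (j , refl))))

  ≤-leftOption : X ≤ Y → Z ∈[ left ] X → Z ◁ Y
  ≤-leftOption {comp L R} {atom y}   (le (f , _)) (i , refl) = lf (f i)
  ≤-leftOption {comp L R} {comp _ _} (le (f , _)) (i , refl) = lf (f i)

  ≤-rightOption : X ≤ Y → Z ∈[ right ] Y → X ◁ Z
  ≤-rightOption {atom x}   {comp L R} (le (f , _)) (j , refl) = lf (f j)
  ≤-rightOption {comp _ _} {comp L R} (le (_ , f)) (j , refl) = lf (f j)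

  ≤-atomic : X ≤ Y → IsAtomic X ⊎ IsAtomic Y → X ◁ Y
  ≤-atomic {atom x}   {atom y}   (le p)     _ = lf p
  ≤-atomic {atom x}   {comp _ _} (le (_ , p)) _ = lf p
  ≤-atomic {comp _ _} {atom y}   (le (_ , p)) _ = lf p
  ≤-atomic {comp _ _} {comp _ _} _ (inj₁ ())
  ≤-atomic {comp _ _} {comp _ _} _ (inj₂ ())

  ◁-rightOption : Z ∈[ right ] X → Z ≤ Y → X ◁ Y
  ◁-rightOption {X = comp L R} {Y = atom y}   (i , refl) (le p) = lf (i , p)
  ◁-rightOption {X = comp L R} {Y = comp _ _} (i , refl) (le p) = lf (inj₁ (i , p))

  ◁-leftOption : Z ∈[ left ] Y → X ≤ Z → X ◁ Y
  ◁-leftOption {Y = comp L R} {X = atom x}   (j , refl) (le p) = lf (j , p)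
  ◁-leftOption {Y = comp L R} {X = comp _ _} (j , refl) (le p) = lf (inj₂ (j , p))

  data ◁-View : Game Carrier → Game Carrier → Set (c ⊔ ℓ₂) where
    viaRight : Z ∈[ right ] X → Z ≤ Y → ◁-View X Y
    viaLeft  : Z ∈[ left ] Y → X ≤ Z → ◁-View X Y
    viaAtoms : x ≤C y → ◁-View (atom x) (atom y)

  ◁-view : X ◁ Y → ◁-View X Y
  ◁-view {atom x}   {atom y}   (lf p)                = viaAtoms p
  ◁-view {atom x}   {comp _ _} (lf (j , p))          = viaLeft (j , refl) (le p)
  ◁-view {comp _ _} {atom y}   (lf (i , p))          = viaRight (i , refl) (le p)
  ◁-view {comp _ _} {comp _ _} (lf (inj₁ (i , p)))   = viaRight (i , refl) (le p)
  ◁-view {comp _ _} {comp _ _} (lf (inj₂ (j , p)))   = viaLeft (j , refl) (le p)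

  private
    mutual
      ≤-trans-acc : Acc _≺_ X → Acc _≺_ Y → Acc _≺_ Z → X ≤ Y → Y ≤ Z → X ≤ Z
      ≤-trans-acc (acc rX) aY (acc rZ) p q = ≤-intro
        (λ m → ◁-≤-trans-acc (rX (option m)) aY (acc rZ) (≤-leftOption p m) q)
        (λ m → ≤-◁-trans-acc (acc rX) aY (rZ (option m)) p (≤-rightOption q m))
        (≤-trans-atomic (acc rX) aY (acc rZ) p q)

      ≤-trans-atomic : Acc _≺_ X → Acc _≺_ Y → Acc _≺_ Z → X ≤ Y → Y ≤ Z
                     → IsAtomic X ⊎ IsAtomic Z → X ◁ Z
      ≤-trans-atomic aX aY aZ p q (inj₁ a) = ◁-≤-trans-acc aX aY aZ (≤-atomic p (inj₁ a)) q
      ≤-trans-atomic aX aY aZ p q (inj₂ a) = ≤-◁-trans-acc aX aY aZ p (≤-atomic q (inj₂ a))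

      ◁-≤-trans-acc : Acc _≺_ X → Acc _≺_ Y → Acc _≺_ Z → X ◁ Y → Y ≤ Z → X ◁ Z
      ◁-≤-trans-acc (acc rX) (acc rY) (acc rZ) p q with ◁-view p
      ... | viaRight m r = ◁-rightOption m (≤-trans-acc (rX (option m)) (acc rY) (acc rZ) r q)
      ... | viaLeft m r  = ≤-◁-trans-acc (acc rX) (rY (option m)) (acc rZ) r (≤-leftOption q m)
      ... | viaAtoms xy with ◁-view (≤-atomic q (inj₁ tt))
      ...   | viaLeft m r  = ◁-leftOption m (≤-trans-acc (acc rX) (acc rY) (rZ (option m)) (≤-atoms xy) r)
      ...   | viaAtoms yz  = lf (≤C-trans xy yz)

      ≤-◁-trans-acc : Acc _≺_ X → Acc _≺_ Y → Acc _≺_ Z → X ≤ Y → Y ◁ Z → X ◁ Z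
      ≤-◁-trans-acc (acc rX) (acc rY) (acc rZ) p q with ◁-view q
      ... | viaRight m r = ◁-≤-trans-acc (acc rX) (rY (option m)) (acc rZ) (≤-rightOption p m) r
      ... | viaLeft m r  = ◁-leftOption m (≤-trans-acc (acc rX) (acc rY) (rZ (option m)) p r)
      ... | viaAtoms yz with ◁-view (≤-atomic p (inj₂ tt))
      ...   | viaRight m r =
                ◁-rightOption m (≤-trans-acc (rX (option m)) (acc rY) (acc rZ) r (≤-atoms yz))
      ...   | viaAtoms xy  = lf (≤C-trans xy yz)

  ≤-trans : X ≤ Y → Y ≤ Z → X ≤ Z
  ≤-trans = ≤-trans-acc (≺-wellFounded _) (≺-wellFounded _) (≺-wellFounded _)

  -- Moving never hurts the mover, at every composite subposition.
  data Eager : Game Carrier → Set (c ⊔ ℓ₂) where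
    atomic    : Eager (atom x)
    composite : (∀ {s Z} → Z ∈[ s ] X → Eager Z)
              → (∃ λ Z → Z ∈[ left ] X × X ≤ Z) → (∃ λ Z → Z ∈[ right ] X × Z ≤ X)
              → Eager X

  eager-option : Z ∈[ s ] X → Eager X → Eager Z
  eager-option m (composite e _ _) = e m

  eager-≤⇒◁ : Eager X ⊎ Eager Y → X ≤ Y → X ◁ Y
  eager-≤⇒◁ (inj₁ atomic)                     p = ≤-atomic p (inj₁ tt)
  eager-≤⇒◁ (inj₁ (composite _ _ (_ , m , q))) p = ◁-rightOption m (≤-trans q p)
  eager-≤⇒◁ (inj₂ atomic)                     p = ≤-atomic p (inj₂ tt)
  eager-≤⇒◁ (inj₂ (composite _ (_ , m , q) _)) p = ◁-leftOption m (≤-trans p q)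

  data _≅_ : Game Carrier → Game Carrier → Set (c ⊔ ℓ₂) where
    atoms      : x ≤C y → y ≤C x → atom x ≅ atom y
    composites : ¬ IsAtomic X → ¬ IsAtomic Y
               → (∀ {s Z} → Z ∈[ s ] X → ∃ λ Z′ → Z′ ∈[ s ] Y × Z ≅ Z′)
               → (∀ {s Z′} → Z′ ∈[ s ] Y → ∃ λ Z → Z ∈[ s ] X × Z ≅ Z′)
               → X ≅ Y

  ≅-sym : X ≅ Y → Y ≅ X
  ≅-sym (atoms p q) = atoms q p
  ≅-sym (composites nX nY f g) = composites nY nX
    (λ m → let Z , m′ , d = g m in Z , m′ , ≅-sym d)
    (λ m → let Z′ , m′ , d = f m in Z′ , m′ , ≅-sym d)

  ≅⇒≤ : X ≅ Y → X ≤ Y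
  ≅⇒≤ (atoms p _) = ≤-atoms p
  ≅⇒≤ (composites nX nY f g) = ≤-intro
    (λ m → let _ , m′ , d = f m in ◁-leftOption m′ (≅⇒≤ d))
    (λ m → let _ , m′ , d = g m in ◁-rightOption m′ (≅⇒≤ d))
    λ where
      (inj₁ a) → ⊥-elim (nX a)
      (inj₂ a) → ⊥-elim (nY a)

-- Sums

module _ {a b} {A : Set a} {B : Set b} where

  private variable
    s : Side
    G Z : Game A
    H W : Game B

  +-optionˡ : Z ∈[ s ] G → (Z +G H) ∈[ s ] (G +G H)
  +-optionˡ {s = left}  {G = comp L R} {H = atom _}   (i , refl) = i , refl
  +-optionˡ {s = right} {G = comp L R} {H = atom _}   (i , refl) = i , refl
  +-optionˡ {s = left}  {G = comp L R} {H = comp _ _} (i , refl) = i ↑ˡ _ , lookup-++ˡ _ _ i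
  +-optionˡ {s = right} {G = comp L R} {H = comp _ _} (i , refl) = i ↑ˡ _ , lookup-++ˡ _ _ i

  +-optionʳ : W ∈[ s ] H → (G +G W) ∈[ s ] (G +G H)
  +-optionʳ {s = left}  {H = comp L R} {G = atom _}          (j , refl) = j , refl
  +-optionʳ {s = right} {H = comp L R} {G = atom _}          (j , refl) = j , refl
  +-optionʳ {s = left}  {H = comp L R} {G = comp {m} L′ R′} (j , refl) =
    suc m ↑ʳ j , lookup-++ʳ (λ i → L′ i +G comp L R) (λ j → comp L′ R′ +G L j) j
  +-optionʳ {s = right} {H = comp L R} {G = comp {n = n} L′ R′} (j , refl) =
    suc n ↑ʳ j , lookup-++ʳ (λ i → R′ i +G comp L R) (λ j → comp L′ R′ +G R j) j

  data +-Option (s : Side) (G : Game A) (H : Game B) : Game (A × B) → Set (a ⊔ b) where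
    viaˡ : Z ∈[ s ] G → +-Option s G H (Z +G H)
    viaʳ : W ∈[ s ] H → +-Option s G H (G +G W)

  +-option-view : ∀ {V} → V ∈[ s ] (G +G H) → +-Option s G H V
  +-option-view {left}  {atom _}   {comp _ _} (j , refl) = viaʳ (j , refl)
  +-option-view {right} {atom _}   {comp _ _} (j , refl) = viaʳ (j , refl)
  +-option-view {left}  {comp _ _} {atom _}   (i , refl) = viaˡ (i , refl)
  +-option-view {right} {comp _ _} {atom _}   (i , refl) = viaˡ (i , refl)
  +-option-view {left}  {comp {m} _ _} {comp _ _} (k , refl) with splitAt (suc m) k
  ... | inj₁ i = viaˡ (i , refl)
  ... | inj₂ j = viaʳ (j , refl)
  +-option-view {right} {comp {n = n} _ _} {comp _ _} (k , refl) with splitAt (suc n) k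
  ... | inj₁ i = viaˡ (i , refl)
  ... | inj₂ j = viaʳ (j , refl)

  +-atomic : IsAtomic (G +G H) → IsAtomic G × IsAtomic H
  +-atomic {atom _}   {atom _}   _ = tt , tt
  +-atomic {atom _}   {comp _ _} ()
  +-atomic {comp _ _} {atom _}   ()
  +-atomic {comp _ _} {comp _ _} ()

module SumOrder {a ℓa ℓa′ b ℓb ℓb′} (PA : Poset a ℓa ℓa′) (PB : Poset b ℓb ℓb′) where

  private
    module A  = GameOrderProperties PA
    module B  = GameOrderProperties PB
    module AB = GameOrderProperties (PA ×P PB)
  open AB using (_≤_; _◁_; lf; ≤-intro; ◁-leftOption; ◁-rightOption)

  private variable
    G G′ : Game (Poset.Carrier PA)
    H H′ : Game (Poset.Carrier PB)

  EagerPairs : Game (Poset.Carrier PA) → Game (Poset.Carrier PA)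
             → Game (Poset.Carrier PB) → Game (Poset.Carrier PB) → Set _
  EagerPairs G G′ H H′ = (A.Eager G ⊎ A.Eager G′) × (B.Eager H ⊎ B.Eager H′)

  private
    Acc₊ : Game (Poset.Carrier PA) → Game (Poset.Carrier PB) → Set _
    Acc₊ G H = Acc _≺_ (G +G H)

    mutual
      +-mono-≤-acc : Acc₊ G H → Acc₊ G′ H′ → EagerPairs G G′ H H′
                   → G A.≤ G′ → H B.≤ H′ → G +G H ≤ G′ +G H′
      +-mono-≤-acc a a′ e p q = ≤-intro
        (+-mono-leftOption a a′ e p q) (+-mono-rightOption a a′ e p q) (+-mono-atomic a a′ e p q)

      +-mono-leftOption : ∀ {V} → Acc₊ G H → Acc₊ G′ H′ → EagerPairs G G′ H H′
                        → G A.≤ G′ → H B.≤ H′ → V ∈[ left ] (G +G H) → V ◁ G′ +G H′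
      +-mono-leftOption (acc r) a′ (eG , eH) p q m with +-option-view m
      ... | viaˡ m₁ =
        +-mono-◁ˡ (r (option m)) a′ (map₁ (A.eager-option m₁) eG , eH) (A.≤-leftOption p m₁) q
      ... | viaʳ m₁ =
        +-mono-◁ʳ (r (option m)) a′ (eG , map₁ (B.eager-option m₁) eH) p (B.≤-leftOption q m₁)

      +-mono-rightOption : ∀ {V} → Acc₊ G H → Acc₊ G′ H′ → EagerPairs G G′ H H′
                         → G A.≤ G′ → H B.≤ H′ → V ∈[ right ] (G′ +G H′) → G +G H ◁ V
      +-mono-rightOption a (acc r′) (eG , eH) p q m with +-option-view m
      ... | viaˡ m₁ =
        +-mono-◁ˡ a (r′ (option m)) (map₂ (A.eager-option m₁) eG , eH) (A.≤-rightOption p m₁) q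
      ... | viaʳ m₁ =
        +-mono-◁ʳ a (r′ (option m)) (eG , map₂ (B.eager-option m₁) eH) p (B.≤-rightOption q m₁)

      +-mono-atomic : Acc₊ G H → Acc₊ G′ H′ → EagerPairs G G′ H H′ → G A.≤ G′ → H B.≤ H′
                    → IsAtomic (G +G H) ⊎ IsAtomic (G′ +G H′) → G +G H ◁ G′ +G H′
      +-mono-atomic {G} a a′ e p q (inj₁ at) =
        +-mono-◁ˡ a a′ e (A.≤-atomic p (inj₁ (proj₁ (+-atomic {G = G} at)))) q
      +-mono-atomic {G′ = G′} a a′ e p q (inj₂ at) =
        +-mono-◁ˡ a a′ e (A.≤-atomic p (inj₂ (proj₁ (+-atomic {G = G′} at)))) q

      +-mono-◁ˡ : Acc₊ G H → Acc₊ G′ H′ → EagerPairs G G′ H H′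
                → G A.◁ G′ → H B.≤ H′ → G +G H ◁ G′ +G H′
      +-mono-◁ˡ (acc r) (acc r′) (eG , eH) p q with A.◁-view p
      ... | A.viaRight m p′ = ◁-rightOption (+-optionˡ m)
              (+-mono-≤-acc (r (option (+-optionˡ m))) (acc r′) (map₁ (A.eager-option m) eG , eH) p′ q)
      ... | A.viaLeft m p′ = ◁-leftOption (+-optionˡ m)
              (+-mono-≤-acc (acc r) (r′ (option (+-optionˡ m))) (map₂ (A.eager-option m) eG , eH) p′ q)
      ... | A.viaAtoms xy with B.◁-view (B.eager-≤⇒◁ eH q)
      ...   | B.viaRight m q′ = ◁-rightOption (+-optionʳ m)
                (+-mono-≤-acc (r (option (+-optionʳ m))) (acc r′) (eG , map₁ (B.eager-option m) eH)
                              (A.≤-atoms xy) q′)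
      ...   | B.viaLeft m q′ = ◁-leftOption (+-optionʳ m)
                (+-mono-≤-acc (acc r) (r′ (option (+-optionʳ m))) (eG , map₂ (B.eager-option m) eH)
                              (A.≤-atoms xy) q′)
      ...   | B.viaAtoms yz = lf (xy , yz)

      +-mono-◁ʳ : Acc₊ G H → Acc₊ G′ H′ → EagerPairs G G′ H H′
                → G A.≤ G′ → H B.◁ H′ → G +G H ◁ G′ +G H′
      +-mono-◁ʳ (acc r) (acc r′) (eG , eH) p q with B.◁-view q
      ... | B.viaRight m q′ = ◁-rightOption (+-optionʳ m)
              (+-mono-≤-acc (r (option (+-optionʳ m))) (acc r′) (eG , map₁ (B.eager-option m) eH) p q′)
      ... | B.viaLeft m q′ = ◁-leftOption (+-optionʳ m)
              (+-mono-≤-acc (acc r) (r′ (option (+-optionʳ m))) (eG , map₂ (B.eager-option m) eH) p q′)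
      ... | B.viaAtoms yz with A.◁-view (A.eager-≤⇒◁ eG p)
      ...   | A.viaRight m p′ = ◁-rightOption (+-optionˡ m)
                (+-mono-≤-acc (r (option (+-optionˡ m))) (acc r′) (map₁ (A.eager-option m) eG , eH)
                              p′ (B.≤-atoms yz))
      ...   | A.viaLeft m p′ = ◁-leftOption (+-optionˡ m)
                (+-mono-≤-acc (acc r) (r′ (option (+-optionˡ m))) (map₂ (A.eager-option m) eG , eH)
                              p′ (B.≤-atoms yz))
      ...   | A.viaAtoms xy = lf (xy , yz)

  +-mono-≤ : EagerPairs G G′ H H′ → G A.≤ G′ → H B.≤ H′ → G +G H ≤ G′ +G H′
  +-mono-≤ = +-mono-≤-acc (≺-wellFounded _) (≺-wellFounded _)

-- Positions of a monotone set coloring game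

colour : Side → Cell
colour left  = ⊤c
colour right = ⊥c

colour≢⋆ : ∀ sd → colour sd ≢ ⋆c
colour≢⋆ left  ()
colour≢⋆ right ()

is⋆? : (v : Cell) → Dec (v ≡ ⋆c)
is⋆? ⊤c = no λ ()
is⋆? ⊥c = no λ ()
is⋆? ⋆c = yes refl

infix 4 _⊑_

data _⊑_ : Cell → Cell → Set where
  ⊥⊑  : ∀ {v} → ⊥c ⊑ v
  ⊑⊤  : ∀ {v} → v ⊑ ⊤c
  ⋆⊑⋆ : ⋆c ⊑ ⋆c

⊑-refl : ∀ {v} → v ⊑ v
⊑-refl {⊤c} = ⊑⊤
⊑-refl {⊥c} = ⊥⊑
⊑-refl {⋆c} = ⋆⊑⋆

⋆⊑-cases : ∀ {v} → ⋆c ⊑ v → v ≡ ⋆c ⊎ ⊤c ⊑ v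
⋆⊑-cases ⊑⊤  = inj₂ ⊑⊤
⋆⊑-cases ⋆⊑⋆ = inj₁ refl

⊑⋆-cases : ∀ {v} → v ⊑ ⋆c → v ≡ ⋆c ⊎ v ⊑ ⊥c
⊑⋆-cases ⊥⊑  = inj₂ ⊥⊑
⊑⋆-cases ⋆⊑⋆ = inj₁ refl

module Positions {c ℓ₁ ℓ₂} {P : Poset c ℓ₁ ℓ₂} (S : MSCG P) where

  open Poset P using (Carrier)
  open MSCG S
  open GameOrderProperties P

  Position : Set
  Position = Fin size → Cell

  private variable
    n k l : ℕ
    sd : Side
    Z : Game Carrier

  #⋆ : (Fin n → Cell) → ℕ
  #⋆ p = length (stars S p)

  stars-⋆ : (p : Fin (suc n) → Cell) → p zero ≡ ⋆c
          → stars S p ≡ zero ∷ map suc (stars S (p ∘ suc))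
  stars-⋆ p e with p zero
  stars-⋆ p refl | ⋆c = refl

  stars-¬⋆ : (p : Fin (suc n) → Cell) → p zero ≢ ⋆c → stars S p ≡ map suc (stars S (p ∘ suc))
  stars-¬⋆ p ne with p zero
  ... | ⊤c = refl
  ... | ⊥c = refl
  ... | ⋆c = ⊥-elim (ne refl)

  #⋆-⋆ : (p : Fin (suc n) → Cell) → p zero ≡ ⋆c → #⋆ p ≡ suc (#⋆ (p ∘ suc))
  #⋆-⋆ p e rewrite stars-⋆ p e = cong suc (length-map suc (stars S (p ∘ suc)))

  #⋆-¬⋆ : (p : Fin (suc n) → Cell) → p zero ≢ ⋆c → #⋆ p ≡ #⋆ (p ∘ suc)
  #⋆-¬⋆ p ne rewrite stars-¬⋆ p ne = length-map suc (stars S (p ∘ suc))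

  stars-complete : (p : Fin n → Cell) {s : Fin n} → p s ≡ ⋆c → s ∈ stars S p
  stars-complete p {zero} e rewrite stars-⋆ p e = here refl
  stars-complete p {suc s} e with is⋆? (p zero)
  ... | yes e₀ rewrite stars-⋆ p e₀  = there (∈-map⁺ suc (stars-complete (p ∘ suc) e))
  ... | no ne₀ rewrite stars-¬⋆ p ne₀ = ∈-map⁺ suc (stars-complete (p ∘ suc) e)

  stars-sound : (p : Fin n → Cell) {s : Fin n} → s ∈ stars S p → p s ≡ ⋆c
  stars-sound {suc n} p m with is⋆? (p zero)
  ... | yes e₀ with subst (_ ∈_) (stars-⋆ p e₀) m
  ...   | here refl = e₀
  ...   | there m′ with ∈-map⁻ suc m′
  ...     | _ , m″ , refl = stars-sound (p ∘ suc) m″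
  stars-sound {suc n} p m | no ne₀ with ∈-map⁻ suc (subst (_ ∈_) (stars-¬⋆ p ne₀) m)
  ... | _ , m′ , refl = stars-sound (p ∘ suc) m′

  infix 4 _⊆⋆_

  _⊆⋆_ : (Fin n → Cell) → (Fin n → Cell) → Set
  p ⊆⋆ q = ∀ i → p i ≡ ⋆c → q i ≡ ⋆c

  #⋆-≤ : (p : Fin n → Cell) → #⋆ p ≤ℕ n
  #⋆-≤ {zero} p = z≤n
  #⋆-≤ {suc n} p with is⋆? (p zero)
  ... | yes e₀ rewrite #⋆-⋆ p e₀  = s≤s (#⋆-≤ (p ∘ suc))
  ... | no ne₀ rewrite #⋆-¬⋆ p ne₀ = m≤n⇒m≤1+n (#⋆-≤ (p ∘ suc))

  #⋆-mono : (p q : Fin n → Cell) → p ⊆⋆ q → #⋆ p ≤ℕ #⋆ q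
  #⋆-mono {zero} p q pq = z≤n
  #⋆-mono {suc n} p q pq
    with is⋆? (p zero) | is⋆? (q zero) | #⋆-mono (p ∘ suc) (q ∘ suc) (pq ∘ suc)
  ... | yes e₀ | _      | tail rewrite #⋆-⋆ p e₀  | #⋆-⋆ q (pq zero e₀) = s≤s tail
  ... | no ne₀ | yes f₀ | tail rewrite #⋆-¬⋆ p ne₀ | #⋆-⋆ q f₀          = m≤n⇒m≤1+n tail
  ... | no ne₀ | no nf₀ | tail rewrite #⋆-¬⋆ p ne₀ | #⋆-¬⋆ q nf₀        = tail

  #⋆-mono-< : (p q : Fin n → Cell) {s : Fin n} → p ⊆⋆ q → p s ≢ ⋆c → q s ≡ ⋆c → #⋆ p <ℕ #⋆ q
  #⋆-mono-< p q {zero} pq ne e rewrite #⋆-¬⋆ p ne | #⋆-⋆ q e =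
    s≤s (#⋆-mono (p ∘ suc) (q ∘ suc) (pq ∘ suc))
  #⋆-mono-< p q {suc s} pq ne e
    with is⋆? (p zero) | is⋆? (q zero) | #⋆-mono-< (p ∘ suc) (q ∘ suc) (pq ∘ suc) ne e
  ... | yes e₀ | _      | tail rewrite #⋆-⋆ p e₀  | #⋆-⋆ q (pq zero e₀) = s≤s tail
  ... | no ne₀ | yes f₀ | tail rewrite #⋆-¬⋆ p ne₀ | #⋆-⋆ q f₀          = m<n⇒m<1+n tail
  ... | no ne₀ | no nf₀ | tail rewrite #⋆-¬⋆ p ne₀ | #⋆-¬⋆ q nf₀        = tail

  #⋆-pos : (p : Fin n → Cell) {s : Fin n} → p s ≡ ⋆c → 0 <ℕ #⋆ p
  #⋆-pos p e with stars S p | stars-complete p e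
  ... | _ ∷ _ | _ = s≤s z≤n

  set-same : (p : Position) (s : Fin size) (v : Cell) → set S p s v s ≡ v
  set-same p s v with s ≟ s
  ... | yes _ = refl
  ... | no ne = ⊥-elim (ne refl)

  set-other : (p : Position) {s j : Fin size} (v : Cell) → s ≢ j → set S p s v j ≡ p j
  set-other p {s} {j} v ne with s ≟ j
  ... | yes e = ⊥-elim (ne e)
  ... | no _  = refl

  set-⊆⋆ : (p : Position) (s : Fin size) {v : Cell} → v ≢ ⋆c → set S p s v ⊆⋆ p
  set-⊆⋆ p s v≢⋆ j e with s ≟ j
  ... | yes refl = ⊥-elim (v≢⋆ e)
  ... | no _     = e

  -- Fuel: ⟦ k ⟧pos p is the intended game as long as k bounds the number of stars.
  fuel-set : (p : Position) {s : Fin size} → p s ≡ ⋆c → #⋆ p ≤ℕ suc k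
           → #⋆ (set S p s (colour sd)) ≤ℕ k
  fuel-set {sd = sd} p {s} e b = s≤s⁻¹ (<-≤-trans (#⋆-mono-< _ p (set-⊆⋆ p s (colour≢⋆ sd)) coloured e) b)
    where
    coloured : set S p s (colour sd) s ≢ ⋆c
    coloured e′ = colour≢⋆ sd (trans (sym (set-same p s _)) e′)

  fuel-suc : (p : Position) {s : Fin size} → p s ≡ ⋆c → #⋆ p ≤ℕ k → ∃ λ k′ → k ≡ suc k′
  fuel-suc {k = zero}  p e b = ⊥-elim (<-irrefl refl (<-≤-trans (#⋆-pos p e) b))
  fuel-suc {k = suc k} p e b = k , refl

  pos : ℕ → Position → Game Carrier
  pos = ⟦_⟧pos S

  star-or-terminal : (p : Position) → (∃ λ s → p s ≡ ⋆c) ⊎ stars S p ≡ []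
  star-or-terminal p with stars S p in e
  ... | []    = inj₂ refl
  ... | s ∷ _ = inj₁ (s , stars-sound p (subst (s ∈_) (sym e) (here refl)))

  pos-terminal : (p : Position) → stars S p ≡ [] → pos k p ≡ atom (φ (toColoring S p))
  pos-terminal p e rewrite e = refl

  pos-option : (p : Position) {s : Fin size} → p s ≡ ⋆c
             → pos k (set S p s (colour sd)) ∈[ sd ] pos (suc k) p
  pos-option {k} {left} p e with stars S p | stars-complete p e
  ... | _ ∷ _ | m = index m , cong (λ s → pos k (set S p s ⊤c)) (sym (lookup-index m))
  pos-option {k} {right} p e with stars S p | stars-complete p e
  ... | _ ∷ _ | m = index m , cong (λ s → pos k (set S p s ⊥c)) (sym (lookup-index m))

  data PosOption (sd : Side) : ℕ → Position → Game Carrier → Set c where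
    move : ∀ {k p s} → p s ≡ ⋆c → PosOption sd (suc k) p (pos k (set S p s (colour sd)))

  pos-option-view : (p : Position) → Z ∈[ sd ] pos k p → PosOption sd k p Z
  pos-option-view {k = zero} p m with stars S p
  pos-option-view {k = zero} p () | []
  pos-option-view {k = zero} p () | _ ∷ _
  pos-option-view {sd = left}  {k = suc k} p m with stars S p in e
  pos-option-view {sd = left}  {k = suc k} p (t , refl) | s ∷ ss =
    move {s = lookup (s ∷ ss) t} (stars-sound p (subst (_ ∈_) (sym e) (∈-lookup t)))
  pos-option-view {sd = right} {k = suc k} p m with stars S p in e
  pos-option-view {sd = right} {k = suc k} p (t , refl) | s ∷ ss =
    move {s = lookup (s ∷ ss) t} (stars-sound p (subst (_ ∈_) (sym e) (∈-lookup t)))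

  infix 4 _⊑ₚ_

  _⊑ₚ_ : Position → Position → Set
  p ⊑ₚ q = ∀ i → p i ⊑ q i

  ⊑ₚ-refl : {p : Position} → p ⊑ₚ p
  ⊑ₚ-refl i = ⊑-refl

  set-⊑ˡ : {p q : Position} (s : Fin size) {v : Cell} → p ⊑ₚ q → v ⊑ q s → set S p s v ⊑ₚ q
  set-⊑ˡ s pq v⊑ j with s ≟ j
  ... | yes refl = v⊑
  ... | no _     = pq j

  set-⊑ʳ : {p q : Position} (s : Fin size) {v : Cell} → p ⊑ₚ q → p s ⊑ v → p ⊑ₚ set S q s v
  set-⊑ʳ s pq ⊑v j with s ≟ j
  ... | yes refl = ⊑v
  ... | no _     = pq j

  set-mono : {p q : Position} (s : Fin size) {v : Cell} → p ⊑ₚ q → set S p s v ⊑ₚ set S q s v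
  set-mono s pq j with s ≟ j
  ... | yes refl = ⊑-refl
  ... | no _     = pq j

  toColoring-mono : {p q : Position} → p ⊑ₚ q → ∀ i → toColoring S p i ≤B toColoring S q i
  toColoring-mono {p} {q} pq i with p i | q i | pq i
  ... | _ | _ | ⊥⊑  = Bool.≤-minimum _
  ... | _ | _ | ⊑⊤  = Bool.≤-maximum _
  ... | _ | _ | ⋆⊑⋆ = Bool.≤-refl

  mutual
    pos-mono : {p q : Position} → #⋆ p ≤ℕ k → #⋆ q ≤ℕ l → p ⊑ₚ q → pos k p ≤ pos l q
    pos-mono bp bq pq = ≤-intro (pos-mono-leftOption bp bq pq) (pos-mono-rightOption bp bq pq)
                                (λ _ → pos-mono-◁ bp bq pq)

    pos-mono-◁ : {p q : Position} → #⋆ p ≤ℕ k → #⋆ q ≤ℕ l → p ⊑ₚ q → pos k p ◁ pos l q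
    pos-mono-◁ {p = p} {q} bp bq pq with star-or-terminal p | star-or-terminal q
    ... | inj₁ (s , e) | _ with fuel-suc p e bp
    ...   | _ , refl = ◁-rightOption (pos-option p e) (pos-mono (fuel-set p e bp) bq (set-⊑ˡ s pq ⊥⊑))
    pos-mono-◁ {p = p} {q} bp bq pq | inj₂ _ | inj₁ (s , e) with fuel-suc q e bq
    ...   | _ , refl = ◁-leftOption (pos-option q e) (pos-mono bp (fuel-set q e bq) (set-⊑ʳ s pq ⊑⊤))
    pos-mono-◁ {k} {l} {p} {q} bp bq pq | inj₂ tp | inj₂ tq
      rewrite pos-terminal {k} p tp | pos-terminal {l} q tq = lf (monotone _ _ (toColoring-mono pq))

    -- Left's move at a starred cell s of p is answered by the same move in q,
    -- unless q already has s coloured ⊤.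
    pos-mono-leftOption : {p q : Position} → #⋆ p ≤ℕ k → #⋆ q ≤ℕ l → p ⊑ₚ q
                        → Z ∈[ left ] pos k p → Z ◁ pos l q
    pos-mono-leftOption {p = p} {q} bp bq pq m with pos-option-view p m
    ... | move {s = s} e with ⋆⊑-cases (subst (_⊑ q s) e (pq s))
    ...   | inj₂ ⊤⊑ = pos-mono-◁ (fuel-set p e bp) bq (set-⊑ˡ s pq ⊤⊑)
    ...   | inj₁ e′ with fuel-suc q e′ bq
    ...     | _ , refl =
      ◁-leftOption (pos-option q e′) (pos-mono (fuel-set p e bp) (fuel-set q e′ bq) (set-mono s pq))

    pos-mono-rightOption : {p q : Position} → #⋆ p ≤ℕ k → #⋆ q ≤ℕ l → p ⊑ₚ q
                         → Z ∈[ right ] pos l q → pos k p ◁ Z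
    pos-mono-rightOption {p = p} {q} bp bq pq m with pos-option-view q m
    ... | move {s = s} e with ⊑⋆-cases (subst (p s ⊑_) e (pq s))
    ...   | inj₂ ⊑⊥ = pos-mono-◁ bp (fuel-set q e bq) (set-⊑ʳ s pq ⊑⊥)
    ...   | inj₁ e′ with fuel-suc p e′ bp
    ...     | _ , refl =
      ◁-rightOption (pos-option p e′) (pos-mono (fuel-set p e′ bp) (fuel-set q e bq) (set-mono s pq))

  pos-eager : {p : Position} → #⋆ p ≤ℕ k → Eager (pos k p)
  pos-eager {k} {p} bp with star-or-terminal p
  ... | inj₂ tp rewrite pos-terminal {k} p tp = atomic
  ... | inj₁ (s , e) with fuel-suc p e bp
  ...   | _ , refl = composite eager-options
          (_ , pos-option p e , pos-mono bp (fuel-set p e bp) (set-⊑ʳ s ⊑ₚ-refl ⊑⊤))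
          (_ , pos-option p e , pos-mono (fuel-set p e bp) bp (set-⊑ˡ s ⊑ₚ-refl ⊥⊑))
    where
    eager-options : ∀ {sd Z} → Z ∈[ sd ] pos (suc _) p → Eager Z
    eager-options m with pos-option-view p m
    ... | move e′ = pos-eager (fuel-set p e′ bp)

  pos-¬atomic : (p : Position) {s : Fin size} → #⋆ p ≤ℕ k → p s ≡ ⋆c → ¬ IsAtomic (pos k p)
  pos-¬atomic p b e with fuel-suc p e b
  ... | _ , refl = option⇒¬atomic (pos-option {sd = left} p e)

  terminal-¬⋆ : (p : Position) {s : Fin size} → stars S p ≡ [] → p s ≢ ⋆c
  terminal-¬⋆ p t e with subst (_ ∈_) t (stars-complete p e)
  ... | ()

  ⟦⟧-eager : Eager ⟦ S ⟧
  ⟦⟧-eager = pos-eager (#⋆-≤ (λ _ → ⋆c))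

-- Juxtaposition of two coloring games

data Split (m n : ℕ) : Fin (m + n) → Set where
  inˡ : (i : Fin m) → Split m n (i ↑ˡ n)
  inʳ : (j : Fin n) → Split m n (m ↑ʳ j)

split : ∀ m n (s : Fin (m + n)) → Split m n s
split m n s with splitAt m s in e
... | inj₁ i = subst (Split m n) (splitAt⁻¹-↑ˡ e) (inˡ i)
... | inj₂ j = subst (Split m n) (splitAt⁻¹-↑ʳ e) (inʳ j)

↑ˡ≢↑ʳ : ∀ {m n} (i : Fin m) (j : Fin n) → i ↑ˡ n ≢ m ↑ʳ j
↑ˡ≢↑ʳ {m} {n} i j e
  with trans (sym (splitAt-↑ˡ m i n)) (trans (cong (splitAt m) e) (splitAt-↑ʳ m n j))
... | ()

toColoring-cong : ∀ {c ℓ₁ ℓ₂ c′ ℓ₁′ ℓ₂′} {P : Poset c ℓ₁ ℓ₂} {Q : Poset c′ ℓ₁′ ℓ₂′}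
                  (S : MSCG P) (T : MSCG Q) (p : Fin (MSCG.size S) → Cell) (q : Fin (MSCG.size T) → Cell)
                  (f : Fin (MSCG.size T) → Fin (MSCG.size S))
                → p ∘ f ≗ q → toColoring S p ∘ f ≗ toColoring T q
toColoring-cong S T p q f e i with p (f i) | q i | e i
... | ⊤c | _ | refl = refl
... | ⊥c | _ | refl = refl
... | ⋆c | _ | refl = refl

module _ {a ℓa ℓa′ b ℓb ℓb′} {PA : Poset a ℓa ℓa′} {PB : Poset b ℓb ℓb′} where

  _⊕_ : MSCG PA → MSCG PB → MSCG (PA ×P PB)
  S ⊕ T = record
    { size     = m + n
    ; φ        = λ u → MSCG.φ S (u ∘ (_↑ˡ n)) , MSCG.φ T (u ∘ (m ↑ʳ_))
    ; monotone = λ u v u≤v →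
        MSCG.monotone S _ _ (u≤v ∘ (_↑ˡ n)) , MSCG.monotone T _ _ (u≤v ∘ (m ↑ʳ_))
    }
    where
    m n : ℕ
    m = MSCG.size S
    n = MSCG.size T

  module ⊕-Properties (S : MSCG PA) (T : MSCG PB) where

    private
      m n : ℕ
      m = MSCG.size S
      n = MSCG.size T
      U : MSCG (PA ×P PB)
      U = S ⊕ T
      module PS = Positions S
      module PT = Positions T
      module PU = Positions U
      open GameOrderProperties (PA ×P PB)

      variable
        k k₁ k₂ : ℕ
        p : PU.Position
        q₁ : PS.Position
        q₂ : PT.Position
        sd : Side
        i : Fin m
        j : Fin n
        v : Cell

    record Coupled (k k₁ k₂ : ℕ) (p : PU.Position) (q₁ : PS.Position) (q₂ : PT.Position) : Set where
      field
        restrictˡ : p ∘ (_↑ˡ n) ≗ q₁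
        restrictʳ : p ∘ (m ↑ʳ_) ≗ q₂
        fuel  : PU.#⋆ p ≤ℕ k
        fuel₁ : PS.#⋆ q₁ ≤ℕ k₁
        fuel₂ : PT.#⋆ q₂ ≤ℕ k₂

    open Coupled

    set-restrictˡ : p ∘ (_↑ˡ n) ≗ q₁ → set U p (i ↑ˡ n) v ∘ (_↑ˡ n) ≗ set S q₁ i v
    set-restrictˡ {i = i} r i′ with i ↑ˡ n ≟ i′ ↑ˡ n | i ≟ i′
    ... | yes _ | yes _    = refl
    ... | no _  | no _     = r i′
    ... | yes e | no ne    = ⊥-elim (ne (↑ˡ-injective n i i′ e))
    ... | no ne | yes refl = ⊥-elim (ne refl)

    set-restrictʳ : p ∘ (m ↑ʳ_) ≗ q₂ → set U p (m ↑ʳ j) v ∘ (m ↑ʳ_) ≗ set T q₂ j v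
    set-restrictʳ {j = j} r j′ with m ↑ʳ j ≟ m ↑ʳ j′ | j ≟ j′
    ... | yes _ | yes _    = refl
    ... | no _  | no _     = r j′
    ... | yes e | no ne    = ⊥-elim (ne (↑ʳ-injective m j j′ e))
    ... | no ne | yes refl = ⊥-elim (ne refl)

    coupled-setˡ : Coupled (suc k) (suc k₁) k₂ p q₁ q₂ → q₁ i ≡ ⋆c
                 → Coupled k k₁ k₂ (set U p (i ↑ˡ n) (colour sd)) (set S q₁ i (colour sd)) q₂
    coupled-setˡ {p = p} {i = i} c e = record
      { restrictˡ = set-restrictˡ {i = i} (restrictˡ c)
      ; restrictʳ = λ j → trans (PU.set-other p _ (↑ˡ≢↑ʳ i j)) (restrictʳ c j)
      ; fuel  = PU.fuel-set p (trans (restrictˡ c i) e) (fuel c)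
      ; fuel₁ = PS.fuel-set _ e (fuel₁ c)
      ; fuel₂ = fuel₂ c
      }

    coupled-setʳ : Coupled (suc k) k₁ (suc k₂) p q₁ q₂ → q₂ j ≡ ⋆c
                 → Coupled k k₁ k₂ (set U p (m ↑ʳ j) (colour sd)) q₁ (set T q₂ j (colour sd))
    coupled-setʳ {p = p} {j = j} c e = record
      { restrictˡ = λ i → trans (PU.set-other p _ (↑ˡ≢↑ʳ i j ∘ sym)) (restrictˡ c i)
      ; restrictʳ = set-restrictʳ {j = j} (restrictʳ c)
      ; fuel  = PU.fuel-set p (trans (restrictʳ c j) e) (fuel c)
      ; fuel₁ = fuel₁ c
      ; fuel₂ = PT.fuel-set _ e (fuel₂ c)
      }

    starˡ : Coupled k k₁ k₂ p q₁ q₂ → p (i ↑ˡ n) ≡ ⋆c → q₁ i ≡ ⋆c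
    starˡ c e = trans (sym (restrictˡ c _)) e

    starʳ : Coupled k k₁ k₂ p q₁ q₂ → p (m ↑ʳ j) ≡ ⋆c → q₂ j ≡ ⋆c
    starʳ c e = trans (sym (restrictʳ c _)) e

    sum-¬atomic : ∀ {s} → Coupled k k₁ k₂ p q₁ q₂ → p s ≡ ⋆c
                → ¬ IsAtomic (PS.pos k₁ q₁ +G PT.pos k₂ q₂)
    sum-¬atomic {k₁ = k₁} {k₂ = k₂} {q₁ = q₁} {q₂} {s} c e at
      with split m n s | +-atomic {G = PS.pos k₁ q₁} {H = PT.pos k₂ q₂} at
    ... | inˡ i | at₁ , _ = PS.pos-¬atomic q₁ (fuel₁ c) (starˡ c e) at₁
    ... | inʳ j | _ , at₂ = PT.pos-¬atomic q₂ (fuel₂ c) (starʳ c e) at₂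

    coupled-≅-terminal : Coupled k k₁ k₂ p q₁ q₂ → stars U p ≡ []
                 → PU.pos k p ≅ PS.pos k₁ q₁ +G PT.pos k₂ q₂
    coupled-≅-terminal {k} {k₁} {k₂} {p} {q₁} {q₂} c t
      with PS.star-or-terminal q₁ | PT.star-or-terminal q₂
    ... | inj₁ (i , e) | _ = ⊥-elim (PU.terminal-¬⋆ p t (trans (restrictˡ c i) e))
    ... | inj₂ _ | inj₁ (j , e) = ⊥-elim (PU.terminal-¬⋆ p t (trans (restrictʳ c j) e))
    ... | inj₂ t₁ | inj₂ t₂
      rewrite PU.pos-terminal {k} p t | PS.pos-terminal {k₁} q₁ t₁ | PT.pos-terminal {k₂} q₂ t₂ =
      atoms (MSCG.monotone S _ _ (Bool.≤-reflexive ∘ colourˡ) ,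
             MSCG.monotone T _ _ (Bool.≤-reflexive ∘ colourʳ))
            (MSCG.monotone S _ _ (Bool.≤-reflexive ∘ sym ∘ colourˡ) ,
             MSCG.monotone T _ _ (Bool.≤-reflexive ∘ sym ∘ colourʳ))
      where
      colourˡ : toColoring U p ∘ (_↑ˡ n) ≗ toColoring S q₁
      colourˡ = toColoring-cong U S p q₁ (_↑ˡ n) (restrictˡ c)
      colourʳ : toColoring U p ∘ (m ↑ʳ_) ≗ toColoring T q₂
      colourʳ = toColoring-cong U T p q₂ (m ↑ʳ_) (restrictʳ c)

    mutual
      coupled-≅ : Coupled k k₁ k₂ p q₁ q₂ → PU.pos k p ≅ PS.pos k₁ q₁ +G PT.pos k₂ q₂
      coupled-≅ {p = p} c with PU.star-or-terminal p
      ... | inj₂ t = coupled-≅-terminal c t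
      ... | inj₁ (s , e) with PU.fuel-suc p e (fuel c)
      ...   | _ , refl =
        composites (PU.pos-¬atomic p (fuel c) e) (sum-¬atomic c e)
                   (coupled-≅-forward c) (coupled-≅-backward c)

      coupled-≅-forward : Coupled (suc k) k₁ k₂ p q₁ q₂ → ∀ {sd Z} → Z ∈[ sd ] PU.pos (suc k) p
                  → ∃ λ Z′ → Z′ ∈[ sd ] (PS.pos k₁ q₁ +G PT.pos k₂ q₂) × Z ≅ Z′
      coupled-≅-forward {p = p} {q₁} {q₂} c o with PU.pos-option-view p o
      ... | PU.move {s = s} e with split m n s
      ...   | inˡ i with PS.fuel-suc q₁ (starˡ c e) (fuel₁ c)
      ...     | _ , refl =
        _ , +-optionˡ (PS.pos-option q₁ (starˡ c e)) , coupled-≅ (coupled-setˡ c (starˡ c e))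
      coupled-≅-forward {p = p} {q₁} {q₂} c o | PU.move e | inʳ j
        with PT.fuel-suc q₂ (starʳ c e) (fuel₂ c)
      ...     | _ , refl =
        _ , +-optionʳ (PT.pos-option q₂ (starʳ c e)) , coupled-≅ (coupled-setʳ c (starʳ c e))

      coupled-≅-backward : Coupled (suc k) k₁ k₂ p q₁ q₂
                   → ∀ {sd Z′} → Z′ ∈[ sd ] (PS.pos k₁ q₁ +G PT.pos k₂ q₂)
                   → ∃ λ Z → Z ∈[ sd ] PU.pos (suc k) p × Z ≅ Z′
      coupled-≅-backward {p = p} {q₁} {q₂} c o with +-option-view o
      ... | viaˡ o₁ with PS.pos-option-view q₁ o₁
      ...   | PS.move {s = i} e =
        _ , PU.pos-option p (trans (restrictˡ c i) e) , coupled-≅ (coupled-setˡ c e)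
      coupled-≅-backward {p = p} {q₁} {q₂} c o | viaʳ o₂ with PT.pos-option-view q₂ o₂
      ...   | PT.move {s = j} e =
        _ , PU.pos-option p (trans (restrictʳ c j) e) , coupled-≅ (coupled-setʳ c e)

    ⟦⊕⟧≅+ : ⟦ S ⊕ T ⟧ ≅ ⟦ S ⟧ +G ⟦ T ⟧
    ⟦⊕⟧≅+ = coupled-≅ record
      { restrictˡ = λ _ → refl ; restrictʳ = λ _ → refl
      ; fuel = PU.#⋆-≤ _ ; fuel₁ = PS.#⋆-≤ _ ; fuel₂ = PT.#⋆-≤ _ }

lemma3p14 : ∀ {a ℓa ℓa' b ℓb ℓb' : Level}
    (A : Poset a ℓa ℓa') (B : Poset b ℓb ℓb') →
    HasTop A → HasBottom A → HasTop B → HasBottom B →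
    (G : Game (Poset.Carrier A)) (H : Game (Poset.Carrier B)) →
    Realizable A G → Realizable B H →
    Realizable (A ×P B) (G +G H)
lemma3p14 A B _ _ _ _ G H (S , G≤S , S≤G) (T , H≤T , T≤H) =
  S ⊕ T , unle G+H≤⟦S⊕T⟧ , unle ⟦S⊕T⟧≤G+H
  where
  open GameOrderProperties (A ×P B)
  open SumOrder A B using (+-mono-≤)
  open ⊕-Properties S T using (⟦⊕⟧≅+)
  open Positions using (⟦⟧-eager)

  G+H≤⟦S⊕T⟧ : G +G H ≤ ⟦ S ⊕ T ⟧
  G+H≤⟦S⊕T⟧ = ≤-trans
    (+-mono-≤ (inj₂ (⟦⟧-eager S) , inj₂ (⟦⟧-eager T))
              (GameOrderProperties.le G≤S) (GameOrderProperties.le H≤T))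
    (≅⇒≤ (≅-sym ⟦⊕⟧≅+))

  ⟦S⊕T⟧≤G+H : ⟦ S ⊕ T ⟧ ≤ G +G H
  ⟦S⊕T⟧≤G+H = ≤-trans
    (≅⇒≤ ⟦⊕⟧≅+)
    (+-mono-≤ (inj₁ (⟦⟧-eager S) , inj₁ (⟦⟧-eager T))
              (GameOrderProperties.le S≤G) (GameOrderProperties.le T≤H))
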